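{- Let $G$ be a finite abelian group and $d',d$ integers with $1 \leq d' \mid d \mid \exp(G)$. Let $S$ be a sequence in $G$, let $T$ be the subsequence of $S$ consisting of all terms whose order divides $d/d'$, and let $U$ be the subsequence of $S$ consisting of all terms whose order divides $d$. If $$|T|+\left\lfloor\frac{|U|-|T|}{\mathsf{D}_{(d',d)}(G)}\right\rfloor \geq \mathsf{D}_{(d/d',\,d/d')}(G),$$ then $S$ is not zero-sumfree.
   Context: A sequence in a finite abelian group $G$ (written additively) is a finite list $S=(g_1,\dots,g_\ell)$ of elements of $G$ (repetitions allowed), of length $|S|=\ell$; a subsequence is a sublist indexed by a subset of $\{1,\dots,\ell\}$. $S$ is zero-sumfree if $\sum_{i\in I} g_i \neq 0$ for every non-empty $I \subseteq \{1,\dots,\ell\}$. For a divisor $k$ of $\exp(G)$, $G_k=\{x\in G : kx=0\}$. For integers $1 \leq d' \mid d \mid \exp(G)$, $\mathsf{D}_{(d',d)}(G)$ is the smallest positive integer $t$ such that every sequence in $G_d$ of length at least $t$ contains a non-empty subsequence whose sum lies in $G_{d/d'}$. (In particular $\mathsf{D}_{(k,k)}(G)$ is the smallest $t$ such that every sequence in $G_k$ of length at least $t$ has a non-empty zero-sum subsequence.) -}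

module Defs where

open import Level using (Level; _⊔_) renaming (suc to lsuc)
open import Algebra.Bundles using (AbelianGroup)
open import Data.Nat using (ℕ; zero; suc; _≤_; _/_)
open import Data.List using (List; []; _∷_; foldr; length; filter)
open import Data.List.Relation.Unary.All using (All)
open import Data.List.Relation.Unary.Any using (Any)
open import Data.List.Relation.Binary.Sublist.Propositional using (_⊆_)
open import Data.Product using (Σ; _×_)
open import Relation.Binary.Definitions using (Decidable)
open import Relation.Binary.PropositionalEquality using (_≢_)
open import Relation.Nullary using (¬_)

record FiniteAbelianGroup (c ℓ : Level) : Set (lsuc (c ⊔ ℓ)) where
  field
    abGroup  : AbelianGroup c ℓ
  open AbelianGroup abGroup public
  field
    _≟_      : Decidable _≈_
    elems    : List Carrier
    complete : ∀ x → Any (x ≈_) elems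

module _ {c ℓ : Level} (G : FiniteAbelianGroup c ℓ) where
  open FiniteAbelianGroup G

  _·_ : ℕ → Carrier → Carrier
  zero  · x = ε
  suc n · x = x ∙ (n · x)

  -- membership in G_k = { x : k x = 0 }
  InG : ℕ → Carrier → Set ℓ
  InG k x = (k · x) ≈ ε

  OrdDivides : Carrier → ℕ → Set ℓ
  OrdDivides x k = InG k x

  ordDivides? : (x : Carrier) (k : ℕ) → Relation.Nullary.Dec (OrdDivides x k)
  ordDivides? x k = (k · x) ≟ ε

  σ : List Carrier → Carrier
  σ = foldr _∙_ ε

  IsExponent : ℕ → Set (c ⊔ ℓ)
  IsExponent e = (1 ≤ e) × (∀ x → InG e x)
               × (∀ m → 1 ≤ m → (∀ x → InG m x) → e ≤ m)

  ZeroSumFree : List Carrier → Set (c ⊔ ℓ)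
  ZeroSumFree S = ∀ (T : List Carrier) → T ⊆ S → T ≢ [] → ¬ (σ T ≈ ε)

  termsOrdDividing : ℕ → List Carrier → List Carrier
  termsOrdDividing k S = filter (λ x → ordDivides? x k) S

-- natural division, total (m div 0 = 0); equals ⌊m / n⌋ for n ≥ 1
_div_ : ℕ → ℕ → ℕ
m div zero    = zero
m div (suc n) = m / suc n

module _ {c ℓ : Level} (G : FiniteAbelianGroup c ℓ) where
  open FiniteAbelianGroup G

  DProp : ℕ → ℕ → ℕ → Set (c ⊔ ℓ)
  DProp d' d t = ∀ (S : List Carrier) → All (InG G d) S → t ≤ length S →
                 Σ (List Carrier) λ T → T ⊆ S × T ≢ [] × InG G (d div d') (σ G T)

  IsD : ℕ → ℕ → ℕ → Set (c ⊔ ℓ)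
  IsD d' d t = (1 ≤ t) × DProp d' d t × (∀ t' → 1 ≤ t' → DProp d' d t' → t ≤ t')

module Submission where

-- Write Φ(S) = t + ⌊(u - t)/D₁⌋ and argue by strong induction on |S|.
-- * If fewer than D₁ terms lie in G_d \ G_k, then Φ(S) = t ≥ D₂, so the
--   G_k-part of S has a non-empty subsum in G_{k/k} = G_1 = {0}.
-- * Otherwise D₁ of those terms contain a non-empty block B with σ B ∈ G_k.
--   As no term of B lies in G_k, |B| ≥ 2.  Replacing B by the single term
--   σ B gives a strictly shorter sequence S' whose potential did not drop
--   (t grows by one, u - t shrinks by at most D₁), and a zero-sum
--   subsequence of S' lifts back to one of S.

open import Defs
open import Data.Nat using (ℕ; _≤_; _+_; _∸_)
open import Data.Nat.Divisibility using (_∣_)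
open import Data.List using (List; length)
open import Relation.Nullary using (¬_)

open import Level using (Level; _⊔_)
open import Data.Nat using (zero; suc; _*_; _<_; _/_; z≤n; s≤s; _≤?_; >-nonZero)
open import Data.Nat.Properties
open import Data.Nat.DivMod using (m<n⇒m/n≡0; m/n≡1+[m∸n]/n; /-monoˡ-≤; n/n≡1; m*[n/m]≡n; m≥n⇒m/n>0)
open import Data.Nat.Divisibility using (0∣⇒≡0; ∣⇒≤)
open import Data.Nat.Induction using (<-wellFounded)
open import Induction.WellFounded using (Acc; acc)
open import Data.List using ([]; _∷_; filter; take)
open import Data.List.Properties using (filter-accept; filter-all; filter-none; length-take)
open import Data.List.Relation.Unary.All using (All; []; _∷_)
open import Data.List.Relation.Unary.All.Properties using (all-filter)
open import Data.List.Relation.Binary.Sublist.Propositional using (_⊆_; []; _∷_; _∷ʳ_; ⊆-trans)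
open import Data.List.Relation.Binary.Sublist.Propositional.Properties
  using (filter-⊆; take-⊆; All-resp-⊆; length-mono-≤)
open import Data.Product using (Σ; _×_; _,_)
open import Data.Empty using (⊥-elim)
open import Relation.Nullary using (yes; no)
open import Relation.Unary using (Pred; Decidable)
open import Relation.Unary.Properties using (∁?)
open import Relation.Binary.PropositionalEquality
  using (_≡_; refl; sym; trans; cong; cong₂; subst; _≢_; module ≡-Reasoning)

module _ {a : Level} {A : Set a} where

  complement : ∀ {xs ys : List A} → xs ⊆ ys → List A
  complement []       = []
  complement (y ∷ʳ τ) = y ∷ complement τ
  complement (_ ∷ τ)  = complement τ

  complement-⊆ : ∀ {xs ys : List A} (τ : xs ⊆ ys) → complement τ ⊆ ys
  complement-⊆ []         = []
  complement-⊆ (y ∷ʳ τ)   = refl ∷ complement-⊆ τ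
  complement-⊆ (refl ∷ τ) = _ ∷ʳ complement-⊆ τ

  length-complement : ∀ {xs ys : List A} (τ : xs ⊆ ys) →
    length (complement τ) + length xs ≡ length ys
  length-complement []         = refl
  length-complement (y ∷ʳ τ)   = cong suc (length-complement τ)
  length-complement (refl ∷ τ) = trans (+-suc _ _) (cong suc (length-complement τ))

  count-complement : ∀ {p} {P : Pred A p} (P? : Decidable P) {xs ys : List A} (τ : xs ⊆ ys) →
    length (filter P? (complement τ)) + length (filter P? xs) ≡ length (filter P? ys)
  count-complement P? [] = refl
  count-complement P? (y ∷ʳ τ) with P? y
  ... | yes _ = cong suc (count-complement P? τ)
  ... | no  _ = count-complement P? τ
  count-complement P? (_∷_ {x = x} refl τ) with P? x
  ... | yes _ = trans (+-suc _ _) (cong suc (count-complement P? τ))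
  ... | no  _ = count-complement P? τ

  -- When P implies Q, the Q-terms are the P-terms together with the Q-terms
  -- outside P; this counts the terms of G_d \ G_k as u - t.
  count-split : ∀ {p q} {P : Pred A p} {Q : Pred A q} (P? : Decidable P) (Q? : Decidable Q) →
    (∀ {x} → P x → Q x) → ∀ xs →
    length (filter P? xs) + length (filter (∁? P?) (filter Q? xs)) ≡ length (filter Q? xs)
  count-split P? Q? P⇒Q [] = refl
  count-split P? Q? P⇒Q (x ∷ xs) with Q? x
  ... | yes _ with P? x
  ...   | yes _ = cong suc (count-split P? Q? P⇒Q xs)
  ...   | no  _ = trans (+-suc _ _) (cong suc (count-split P? Q? P⇒Q xs))
  count-split P? Q? P⇒Q (x ∷ xs) | no ¬q with P? x
  ...   | yes p = ⊥-elim (¬q (P⇒Q p))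
  ...   | no  _ = count-split P? Q? P⇒Q xs

module GroupFacts {c ℓ : Level} (G : FiniteAbelianGroup c ℓ) where
  open FiniteAbelianGroup G
    using (Carrier; _≈_; _∙_; ε; setoid; assoc; identityˡ; identityʳ; ∙-cong; commutativeSemigroup)
  open import Relation.Binary.Bundles using (Setoid)
  open import Algebra.Properties.CommutativeSemigroup commutativeSemigroup using (x∙yz≈y∙xz)
  module ≈ = Setoid setoid

  _⋅_ : ℕ → Carrier → Carrier
  _⋅_ = _·_ G

  ⋅-cong : ∀ n {x y} → x ≈ y → n ⋅ x ≈ n ⋅ y
  ⋅-cong zero    _   = ≈.refl
  ⋅-cong (suc n) x≈y = ∙-cong x≈y (⋅-cong n x≈y)

  ⋅-distrib-+ : ∀ m n x → (m + n) ⋅ x ≈ m ⋅ x ∙ n ⋅ x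
  ⋅-distrib-+ zero    n x = ≈.sym (identityˡ _)
  ⋅-distrib-+ (suc m) n x = ≈.trans (∙-cong ≈.refl (⋅-distrib-+ m n x)) (≈.sym (assoc _ _ _))

  InG-resp-≈ : ∀ k {x y} → x ≈ y → InG G k x → InG G k y
  InG-resp-≈ k x≈y kx≈0 = ≈.trans (⋅-cong k (≈.sym x≈y)) kx≈0

  InG-multiple : ∀ m k {x} → InG G k x → InG G (m * k) x
  InG-multiple zero    k kx≈0 = ≈.refl
  InG-multiple (suc m) k {x} kx≈0 =
    ≈.trans (⋅-distrib-+ k (m * k) x) (≈.trans (∙-cong kx≈0 (InG-multiple m k kx≈0)) (identityˡ ε))

  InG-quotient : ∀ {d' d x} → 1 ≤ d' → d' ∣ d → InG G (d div d') x → InG G d x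
  InG-quotient {suc d''} {d} {x} _ d'∣d h = subst (λ m → InG G m x) (m*[n/m]≡n d'∣d) (InG-multiple (suc d'') (d div suc d'') h)

  InG-1 : ∀ {x} → InG G 1 x → x ≈ ε
  InG-1 {x} 1x≈0 = ≈.trans (≈.sym (identityʳ x)) 1x≈0

  HasZeroSum : List Carrier → Set (c ⊔ ℓ)
  HasZeroSum S = Σ (List Carrier) λ W → W ⊆ S × W ≢ [] × σ G W ≈ ε

  hasZeroSum⇒¬zeroSumFree : ∀ {S} → HasZeroSum S → ¬ ZeroSumFree G S
  hasZeroSum⇒¬zeroSumFree (W , W⊆S , W≢[] , σW≈0) zsf = zsf W W⊆S W≢[] σW≈0

  merge : ∀ {B S} (τ : B ⊆ S) {R} → R ⊆ complement τ →
    Σ (List Carrier) λ W → W ⊆ S × σ G W ≈ σ G B ∙ σ G R × (B ≢ [] → W ≢ [])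
  merge [] [] = [] , [] , ≈.sym (identityˡ ε) , λ B≢[] → ⊥-elim (B≢[] refl)
  merge (y ∷ʳ τ) (.y ∷ʳ ρ) with merge τ ρ
  ... | W , W⊆S , σW , ne = W , y ∷ʳ W⊆S , σW , ne
  merge {B} (y ∷ʳ τ) {.y ∷ R} (refl ∷ ρ) with merge τ ρ
  ... | W , W⊆S , σW , _ =
    y ∷ W , refl ∷ W⊆S , ≈.trans (∙-cong ≈.refl σW) (x∙yz≈y∙xz y (σ G B) (σ G R)) , λ _ ()
  merge (_∷_ {x = x} {xs = B} refl τ) {R} ρ with merge τ ρ
  ... | W , W⊆S , σW , _ =
    x ∷ W , refl ∷ W⊆S , ≈.trans (∙-cong ≈.refl σW) (≈.sym (assoc x (σ G B) (σ G R))) , λ _ ()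

  lift-zero-sum : ∀ {B S} (τ : B ⊆ S) → B ≢ [] → HasZeroSum (σ G B ∷ complement τ) → HasZeroSum S
  lift-zero-sum τ _ (W , _ ∷ʳ W⊆C , W≢[] , σW≈0) = W , ⊆-trans W⊆C (complement-⊆ τ) , W≢[] , σW≈0
  lift-zero-sum τ B≢[] (_ , refl ∷ R⊆C , _ , σW≈0) with merge τ R⊆C
  ... | W , W⊆S , σW , ne = W , W⊆S , ne B≢[] , ≈.trans σW σW≈0

div-small : ∀ {m n} → m < n → m div n ≡ 0
div-small {n = suc _} m<n = m<n⇒m/n≡0 m<n

div-self : ∀ {k} → 1 ≤ k → k div k ≡ 1
div-self {suc k} _ = n/n≡1 (suc k)

div-step : ∀ {D x x'} → 1 ≤ D → D ≤ x → x ∸ D ≤ x' → x div D ≤ suc (x' div D)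
div-step {suc D} {x} {x'} _ D≤x x∸D≤x' = begin
  x / suc D                   ≡⟨ m/n≡1+[m∸n]/n D≤x ⟩
  suc ((x ∸ suc D) / suc D)   ≤⟨ s≤s (/-monoˡ-≤ (suc D) x∸D≤x') ⟩
  suc (x' / suc D)            ∎
  where open ≤-Reasoning

-- k = d/d' ≥ 1: d is positive as a divisor of exp(G) ≥ 1, and d' ≤ d.
divisor-positive : ∀ {m n} → 1 ≤ n → m ∣ n → 1 ≤ m
divisor-positive {zero} 1≤n m∣n with 0∣⇒≡0 m∣n
divisor-positive {zero} () m∣n | refl
divisor-positive {suc m} _ _ = s≤s z≤n

quotient-positive : ∀ {d' d} → 1 ≤ d' → d' ∣ d → 1 ≤ d → 1 ≤ d div d'
quotient-positive {suc d''} {d} _ d'∣d 1≤d =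
  m≥n⇒m/n>0 (∣⇒≤ ⦃ >-nonZero 1≤d ⦄ d'∣d)

module ZeroSumSearch {c ℓ : Level} (G : FiniteAbelianGroup c ℓ) (d' d D₁ D₂ : ℕ)
  (k≥1 : 1 ≤ d div d')
  (Gk⊆Gd : ∀ {x} → InG G (d div d') x → InG G d x)
  (D₁≥1 : 1 ≤ D₁)
  (D₁-prop : DProp G d' d D₁)
  (D₂-prop : DProp G (d div d') (d div d') D₂) where
  open FiniteAbelianGroup G using (Carrier; identityʳ)
  open GroupFacts G

  k : ℕ
  k = d div d'

  T? : Decidable (InG G k)
  T? x = ordDivides? G x k

  U? : Decidable (InG G d)
  U? x = ordDivides? G x d

  t u excess Φ : List Carrier → ℕ
  t S      = length (termsOrdDividing G k S)
  u S      = length (termsOrdDividing G d S)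
  excess S = u S ∸ t S
  Φ S      = t S + excess S div D₁

  -- Base case: with excess S < D₁, Φ S = t S, so the G_k-part of S is long
  -- enough for D₂ and has a non-empty subsum in G_{k/k} = G_1 = {0}.
  zeroSum-in-Gk : ∀ S → excess S < D₁ → D₂ ≤ Φ S → HasZeroSum S
  zeroSum-in-Gk S few D₂≤Φ with D₂-prop (termsOrdDividing G k S) (all-filter T? S) D₂≤t
    where
    D₂≤t : D₂ ≤ t S
    D₂≤t = subst (D₂ ≤_) (trans (cong (t S +_) (div-small few)) (+-identityʳ (t S))) D₂≤Φ
  ... | W , W⊆T , W≢[] , σW∈G₁ =
    W , ⊆-trans W⊆T (filter-⊆ T? S) , W≢[] , InG-1 (subst (λ m → InG G m (σ G W)) (div-self k≥1) σW∈G₁)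

  record Block (S : List Carrier) : Set (c ⊔ ℓ) where
    field
      terms     : List Carrier
      embedding : terms ⊆ S
      nonEmpty  : terms ≢ []
      small     : length terms ≤ D₁
      outsideGk : All (λ x → ¬ InG G k x) terms
      insideGd  : All (InG G d) terms
      sumInGk   : InG G k (σ G terms)

  outsiders candidates : List Carrier → List Carrier
  outsiders S  = filter (∁? T?) (termsOrdDividing G d S)
  candidates S = take D₁ (outsiders S)

  candidates⊆outsiders : ∀ S → candidates S ⊆ outsiders S
  candidates⊆outsiders S = take-⊆ D₁ (outsiders S)

  outsiders⊆S : ∀ S → outsiders S ⊆ S
  outsiders⊆S S = ⊆-trans (filter-⊆ (∁? T?) (termsOrdDividing G d S)) (filter-⊆ U? S)

  outsiders-in-Gd : ∀ S → All (InG G d) (outsiders S)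
  outsiders-in-Gd S = All-resp-⊆ (filter-⊆ (∁? T?) (termsOrdDividing G d S)) (all-filter U? S)

  length-outsiders : ∀ S → length (outsiders S) ≡ excess S
  length-outsiders S =
    sym (trans (cong (_∸ t S) (sym (count-split T? U? Gk⊆Gd S))) (m+n∸m≡n (t S) (length (outsiders S))))

  length-candidates : ∀ S → D₁ ≤ excess S → length (candidates S) ≡ D₁
  length-candidates S many =
    trans (length-take D₁ (outsiders S)) (m≤n⇒m⊓n≡m (subst (D₁ ≤_) (sym (length-outsiders S)) many))

  findBlock : ∀ S → D₁ ≤ excess S → Block S
  findBlock S many
    with D₁-prop (candidates S) (All-resp-⊆ (candidates⊆outsiders S) (outsiders-in-Gd S))
                 (subst (_≤ length (candidates S)) (length-candidates S many) ≤-refl)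
  ... | B , B⊆C , B≢[] , σB∈Gk = record
    { terms     = B
    ; embedding = ⊆-trans B⊆O (outsiders⊆S S)
    ; nonEmpty  = B≢[]
    ; small     = subst (length B ≤_) (length-candidates S many) (length-mono-≤ B⊆C)
    ; outsideGk = All-resp-⊆ B⊆O (all-filter (∁? T?) (termsOrdDividing G d S))
    ; insideGd  = All-resp-⊆ B⊆O (outsiders-in-Gd S)
    ; sumInGk   = σB∈Gk
    }
    where
    B⊆O : B ⊆ outsiders S
    B⊆O = ⊆-trans B⊆C (candidates⊆outsiders S)

  module _ {S : List Carrier} (b : Block S) where
    open Block b

    contract : List Carrier
    contract = σ G terms ∷ complement embedding

    -- A block has at least two terms: a single term outside G_k cannot sum into G_k.
    block-long : 2 ≤ length terms
    block-long with terms | nonEmpty | outsideGk | sumInGk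
    ... | []        | ne | _         | _ = ⊥-elim (ne refl)
    ... | x ∷ []    | _  | x∉Gk ∷ [] | s = ⊥-elim (x∉Gk (InG-resp-≈ k (identityʳ x) s))
    ... | _ ∷ _ ∷ _ | _  | _         | _ = s≤s (s≤s z≤n)

    contract-shorter : length contract < length S
    contract-shorter = begin
      suc (suc (length (complement embedding)))    ≤⟨ +-monoˡ-≤ (length (complement embedding)) block-long ⟩
      length terms + length (complement embedding) ≡⟨ +-comm (length terms) _ ⟩
      length (complement embedding) + length terms ≡⟨ length-complement embedding ⟩
      length S                                     ∎
      where open ≤-Reasoning

    t-complement : t (complement embedding) ≡ t S
    t-complement = begin
      t (complement embedding)                                  ≡⟨ +-identityʳ _ ⟨
      t (complement embedding) + 0                              ≡⟨ cong (t (complement embedding) +_) (cong length (filter-none T? outsideGk)) ⟨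
      t (complement embedding) + t terms                        ≡⟨ count-complement T? embedding ⟩
      t S                                                       ∎
      where open ≡-Reasoning

    u-complement : u (complement embedding) ≡ u S ∸ length terms
    u-complement = begin
      u (complement embedding)                                  ≡⟨ m+n∸n≡m _ (length terms) ⟨
      u (complement embedding) + length terms ∸ length terms    ≡⟨ cong (λ m → u (complement embedding) + m ∸ length terms) (cong length (filter-all U? insideGd)) ⟨
      u (complement embedding) + u terms ∸ length terms         ≡⟨ cong (_∸ length terms) (count-complement U? embedding) ⟩
      u S ∸ length terms                                        ∎
      where open ≡-Reasoning

    t-contract : t contract ≡ suc (t S)
    t-contract = trans (cong length (filter-accept T? sumInGk)) (cong suc t-complement)

    -- The block removes at most D₁ terms of G_d \ G_k; σ B itself lies in G_k.
    excess-contract : excess S ∸ D₁ ≤ excess contract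
    excess-contract = begin
      excess S ∸ D₁                          ≤⟨ ∸-monoʳ-≤ (excess S) small ⟩
      (u S ∸ t S) ∸ length terms             ≡⟨ ∸-+-assoc (u S) (t S) (length terms) ⟩
      u S ∸ (t S + length terms)             ≡⟨ cong (u S ∸_) (+-comm (t S) (length terms)) ⟩
      u S ∸ (length terms + t S)             ≡⟨ ∸-+-assoc (u S) (length terms) (t S) ⟨
      (u S ∸ length terms) ∸ t S             ≡⟨ cong (_∸ t S) u-complement ⟨
      u (complement embedding) ∸ t S         ≡⟨ cong₂ _∸_ (cong length (filter-accept U? (Gk⊆Gd sumInGk))) t-contract ⟨
      excess contract                        ∎
      where open ≤-Reasoning

    Φ-contract : D₁ ≤ excess S → Φ S ≤ Φ contract
    Φ-contract many = begin
      t S + excess S div D₁                   ≤⟨ +-monoʳ-≤ (t S) (div-step D₁≥1 many excess-contract) ⟩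
      t S + suc (excess contract div D₁)      ≡⟨ +-suc (t S) _ ⟩
      suc (t S) + excess contract div D₁      ≡⟨ cong (_+ excess contract div D₁) t-contract ⟨
      Φ contract                              ∎
      where open ≤-Reasoning

  zeroSum : ∀ S → Acc _<_ (length S) → D₂ ≤ Φ S → HasZeroSum S
  zeroSum S (acc smaller) D₂≤Φ with D₁ ≤? excess S
  ... | no  few  = zeroSum-in-Gk S (≰⇒> few) D₂≤Φ
  ... | yes many =
    lift-zero-sum (Block.embedding b) (Block.nonEmpty b)
      (zeroSum (contract b) (smaller (contract-shorter b)) (≤-trans D₂≤Φ (Φ-contract b many)))
    where b = findBlock S many

lemma4p1 : ∀ {c ℓ} (G : FiniteAbelianGroup c ℓ) (d' d e D₁ D₂ : ℕ) →
  1 ≤ d' → d' ∣ d → d ∣ e → IsExponent G e →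
  IsD G d' d D₁ → IsD G (d div d') (d div d') D₂ →
  (S : List (FiniteAbelianGroup.Carrier G)) →
  D₂ ≤ length (termsOrdDividing G (d div d') S)
       + ((length (termsOrdDividing G d S) ∸ length (termsOrdDividing G (d div d') S)) div D₁) →
  ¬ ZeroSumFree G S
lemma4p1 G d' d e D₁ D₂ d'≥1 d'∣d d∣e (e≥1 , _) (D₁≥1 , D₁-prop , _) (_ , D₂-prop , _) S D₂≤Φ =
  hasZeroSum⇒¬zeroSumFree (zeroSum S (<-wellFounded (length S)) D₂≤Φ)
  where
  open GroupFacts G
  d≥1 : 1 ≤ d
  d≥1 = divisor-positive e≥1 d∣e
  open ZeroSumSearch G d' d D₁ D₂ (quotient-positive d'≥1 d'∣d d≥1)
    (InG-quotient d'≥1 d'∣d) D₁≥1 D₁-prop D₂-prop
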